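{- Suppose that $X$ is $H$-ordered for some integer $H\ge0$, and run Algorithm B (described in the context). Then for any guess $\gamma\in\Gamma$ and any time $t$, $|A^{\gamma,t}|+|R^{\gamma,t}|=O(\min\{k+H,|X_t|\})$, where $A^{\gamma,t},R^{\gamma,t}$ denote the sets $A^\gamma,R^\gamma$ either after the call $\textsc{Update}_{6+\varepsilon}(p)$ with $t_{\rm arr}(p)=t$ or after the removal of expired points at the start of $\textsc{Query}_{6+\varepsilon}(t)$.
   Context: Let $(\mathcal U,d)$ be a metric space, $X\subseteq\mathcal U$ finite, $k\ge1$ an integer. Each $p\in X$ has an arrival time $t_{\rm arr}(p)\in\mathbb N$ and a deletion time $t_{\rm del}(p)\in\mathbb N$ with $t_{\rm arr}(p)<t_{\rm del}(p)$; arrival times are pairwise distinct, and points are presented in order of arrival. The active set at time $t$ is $X_t=\{p\in X: t_{\rm arr}(p)\le t<t_{\rm del}(p)\}$. $X$ is called $H$-ordered if for every $p,q\in X$ with $t_{\rm arr}(p)<t_{\rm arr}(q)$ and $|\{x\in X: t_{\rm arr}(p)<t_{\rm arr}(x)<t_{\rm arr}(q)\}|\ge H$, we have $t_{\rm del}(p)<t_{\rm del}(q)$. Let $d_{\min},d_{\max}$ be the minimum and maximum distance between two distinct points of $X$ (assumed known), $\Delta=d_{\max}/d_{\min}$. Let $\varepsilon>0$, $\beta=\varepsilon/6$, and $\Gamma=\{(1+\beta)^i:\lfloor\log_{1+\beta}d_{\min}\rfloor\le i\le\lceil\log_{1+\beta}d_{\max}\rceil\}$. Algorithm B: for each $\gamma\in\Gamma$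 it maintains a set $A^\gamma$ of attractors, a map $rep^\gamma$ assigning to each attractor a representative, and a set $R^\gamma$ of representatives (the current representatives of the attractors, plus representatives whose attractors have been removed from $A^\gamma$). Initially all are empty. $\textsc{Update}_{6+\varepsilon}(p)$, called at arrival of $p$: for each $\gamma\in\Gamma$: (i) remove from $A^\gamma$ and $R^\gamma$ every $x$ with $t_{\rm del}(x)\le t_{\rm arr}(p)$; (ii) let $E=\{a\in A^\gamma:d(a,p)\le2\gamma\}$; (iii) if $E=\emptyset$: add $p$ to $A^\gamma$, set $rep^\gamma(p)=p$, add $p$ to $R^\gamma$, and run $\textsc{Cleanup}(\gamma)$; (iv) otherwise let $E'=\{a\in E: t_{\rm del}(rep^\gamma(a))<t_{\rm del}(p)\}$; if $E'\ne\emptyset$, pick an arbitrary $a\in E'$, remove $rep^\gamma(a)$ from $R^\gamma$, set $rep^\gamma(a)=p$ and add $p$ to $R^\gamma$; if $E'=\emptyset$, $p$ is discarded. $\textsc{Cleanup}(\gamma)$: if $|A^\gamma|=k+2$, remove from $A^\gamma$ the attractor with minimum deletion time. Then, if $|A^\gamma|=k+1$, let $t_{\min}=\min_{a\in A^\gamma}t_{\rm del}(a)$ and remove from $R^\gamma$ all $q$ with $t_{\rm del}(q)<t_{\min}$. $\textsc{Query}_{6+\varepsilon}(t)$ begins by removing, for each $\gamma$, all points $x$ with $t_{\rm del}(x)\le t$ from $A^\gamma$ and $R^\gamma$. -}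

module Defs where

open import Data.Nat using (ℕ; zero; suc; _+_; _≤_; _<_; _≤ᵇ_; _<ᵇ_)
open import Data.Bool using (Bool; true; false; _∧_; if_then_else_)
open import Data.Fin using (Fin; toℕ; _≟_)
open import Data.Fin.Subset using (Subset; _∈_; _∩_; _∪_; _-_; ⁅_⁆; ∣_∣; Empty; Nonempty; ⊥)
open import Data.Vec using (tabulate)
open import Relation.Nullary using (¬_; does)
open import Relation.Binary.PropositionalEquality using (_≡_)

-- An input instance, restricted to ONE fixed guess γ.
-- Points of X are indexed by Fin n, in order of arrival (see `ArrivalOrdered`).
-- near a p = true  iff  d(a,p) ≤ 2γ  (the only way the metric and γ enter
-- Algorithm B for a fixed guess γ).
record Instance : Set where
  field
    n    : ℕ
    k    : ℕ
    arr  : Fin n → ℕ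
    del  : Fin n → ℕ
    near : Fin n → Fin n → Bool

module _ (I : Instance) where
  open Instance I

  ArrivalOrdered : Set
  ArrivalOrdered = ∀ (i j : Fin n) → toℕ i < toℕ j → arr i < arr j

  ArrBeforeDel : Set
  ArrBeforeDel = ∀ (p : Fin n) → arr p < del p

  between : Fin n → Fin n → Subset n
  between p q = tabulate (λ x → (arr p <ᵇ arr x) ∧ (arr x <ᵇ arr q))

  HOrdered : ℕ → Set
  HOrdered H = ∀ (p q : Fin n) → arr p < arr q → H ≤ ∣ between p q ∣ → del p < del q

  active : ℕ → Subset n
  active t = tabulate (λ x → (arr x ≤ᵇ t) ∧ (t <ᵇ del x))

  record State : Set where
    constructor st
    field
      A   : Subset n
      rep : Fin n → Fin n
      R   : Subset n
  open State public

  initial : State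
  initial = st ⊥ (λ x → x) ⊥

  expire : ℕ → State → State
  expire τ s = st (A s ∩ alive) (rep s) (R s ∩ alive)
    where alive = tabulate (λ x → τ <ᵇ del x)

  setRep : (Fin n → Fin n) → Fin n → Fin n → Fin n → Fin n
  setRep r a p x = if does (x ≟ a) then p else r x

  data Cleanup₁ : State → State → Set where
    rem  : ∀ s a → ∣ A s ∣ ≡ suc (suc k) → a ∈ A s →
           (∀ b → b ∈ A s → del a ≤ del b) →
           Cleanup₁ s (st (A s - a) (rep s) (R s))
    skip : ∀ s → ¬ (∣ A s ∣ ≡ suc (suc k)) → Cleanup₁ s s

  data Cleanup₂ : State → State → Set where
    prune : ∀ s a₀ → ∣ A s ∣ ≡ suc k → a₀ ∈ A s →
            (∀ b → b ∈ A s → del a₀ ≤ del b) →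
            Cleanup₂ s (st (A s) (rep s) (R s ∩ tabulate (λ q → del a₀ ≤ᵇ del q)))
    skip : ∀ s → ¬ (∣ A s ∣ ≡ suc k) → Cleanup₂ s s

  data Cleanup : State → State → Set where
    cleanup : ∀ {s s₁ s₂} → Cleanup₁ s s₁ → Cleanup₂ s₁ s₂ → Cleanup s s₂

  Eset : State → Fin n → Subset n
  Eset s p = A s ∩ tabulate (λ a → near a p)

  E'set : State → Fin n → Subset n
  E'set s p = Eset s p ∩ tabulate (λ a → del (rep s a) <ᵇ del p)

  -- steps (ii)-(iv) of Update, applied to the state s after expiry (i);
  -- the arbitrary choices are modelled nondeterministically
  data Insert : State → Fin n → State → Set where
    new     : ∀ {s s'} p → Empty (Eset s p) →
              Cleanup (st (A s ∪ ⁅ p ⁆) (setRep (rep s) p p) (R s ∪ ⁅ p ⁆)) s' →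
              Insert s p s'
    swap    : ∀ s p a → Nonempty (Eset s p) → a ∈ E'set s p →
              Insert s p (st (A s) (setRep (rep s) a p) ((R s - rep s a) ∪ ⁅ p ⁆))
    discard : ∀ s p → Nonempty (Eset s p) → Empty (E'set s p) → Insert s p s

  Update : State → Fin n → State → Set
  Update s p s' = Insert (expire (arr p) s) p s'

  data Run : ℕ → State → Set where
    start : Run 0 initial
    step  : ∀ {s s'} (p : Fin n) → Run (toℕ p) s → Update s p s' → Run (suc (toℕ p)) s'

{-# OPTIONS --safe #-}
module Submission where

-- Cleanup keeps at most k + 1 attractors, and whatever A and R hold after an update or the
-- expiry step of a query is active, which gives the bound |X_t|.  A representative q in R
-- represents either a current attractor or an attractor a that has been evicted, and a is
-- evicted in one of two ways.  If a had expired, let x be the last expired point: either q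
-- arrived before x and, being deleted after x, lies within H before x, or a was still an
-- attractor right after x arrived.  Otherwise Cleanup evicted a and pruned R below the
-- oldest surviving attractor b; for the last such pruning, either q lies within H before b,
-- or a lies within H after b (a is deleted no later than b), or a was an attractor right
-- after b arrived.  Each of these sets has at most k + 1 or H + 1 elements.

open import Defs
open import Data.Nat using (ℕ; zero; suc; _+_; _*_; _∸_; _≤_; _<_; _⊓_; z≤n; s≤s; s≤s⁻¹; _<ᵇ_)
open import Data.Nat using () renaming (_≟_ to _≟ℕ_)
open import Data.Nat.Properties hiding (_≟_)
open import Data.Nat.Tactic.RingSolver using (solve-∀)
open import Data.Bool using (Bool; T; if_then_else_)
open import Data.Bool.Properties using (T-≡; T-∧)
open import Data.Fin using (Fin; zero; suc; toℕ; fromℕ<; _≟_)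
open import Data.Fin.Properties using (toℕ-injective; toℕ-fromℕ<; toℕ<n; any?; all?)
open import Data.Fin.Subset using (Subset; _∈_; _∉_; _∩_; _∪_; _─_; _-_; ⁅_⁆; ∣_∣; inside; outside)
open import Data.Fin.Subset.Properties
  using (p─⊥≡p; p─q⊆p; p⊆q⇒∣p∣≤∣q∣; x∈p∧x≢y⇒x∈p-y; x∈p⇒∣p-x∣<∣p∣; x∈p∪q⁻; x∈p∪q⁺; x∈p∩q⁺; x∈p∩q⁻; x∈⁅x⁆; x∈⁅y⁆⇒x≡y;
         Empty-unique; ∉⊥; ∣⊥∣≡0; ∣p∩q∣≤∣p∣; _∈?_)
open import Data.Vec using (_∷_; []; tabulate; here; there)
open import Data.Vec.Properties using (lookup∘tabulate; []=⇒lookup; lookup⇒[]=)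
open import Data.List using (List; []; _∷_; length; map; _++_)
open import Data.List.Properties using (length-map; length-++)
open import Data.List.Relation.Unary.Any using (here; there)
open import Data.List.Membership.Propositional using () renaming (_∈_ to _∈ₗ_)
open import Data.List.Membership.Propositional.Properties using (∈-map⁺; ∈-++⁺ˡ; ∈-++⁺ʳ)
open import Data.Product using (∃; Σ; _×_; _,_; proj₁; proj₂)
import Data.Product
open import Data.Sum using (_⊎_; inj₁; inj₂; [_,_]′)
import Data.Sum
open import Data.Empty using (⊥-elim)
open import Function.Base using (_∘_; case_of_)
open import Function.Bundles using (Equivalence)
open import Relation.Nullary using (¬_; Dec; yes; no; does)
open import Relation.Nullary.Decidable using (dec-true; dec-false; _×-dec_; _→-dec_)
open import Relation.Binary.PropositionalEquality using (_≡_; _≢_; refl; sym; trans; cong; subst; subst₂)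

open Equivalence using (to; from)

∈-tabulate⁺ : ∀ {n} {f : Fin n → Bool} {x} → T (f x) → x ∈ tabulate f
∈-tabulate⁺ {f = f} {x} fx = lookup⇒[]= x (tabulate f) (trans (lookup∘tabulate f x) (to T-≡ fx))

∈-tabulate⁻ : ∀ {n} {f : Fin n → Bool} {x} → x ∈ tabulate f → T (f x)
∈-tabulate⁻ {f = f} {x} x∈ = from T-≡ (trans (sym (lookup∘tabulate f x)) ([]=⇒lookup x∈))

-- the cases with x = zero are absurd: p ─ q is outside wherever q is inside
x∈p─q⇒x∉q : ∀ {n} (p q : Subset n) {x} → x ∈ p ─ q → x ∉ q
x∈p─q⇒x∉q (_ ∷ p) (_ ∷ q) (there x∈) (there x∈q) = x∈p─q⇒x∉q p q x∈ x∈q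

x∈p-y⇒x≢y : ∀ {n} (p : Subset n) {x y} → x ∈ p - y → x ≢ y
x∈p-y⇒x≢y p {y = y} x∈ refl = x∈p─q⇒x∉q p ⁅ y ⁆ x∈ (x∈⁅x⁆ y)

∈-∪⁅⁆⁻ : ∀ {n} {p : Subset n} {x y} → x ∈ p ∪ ⁅ y ⁆ → x ∈ p ⊎ x ≡ y
∈-∪⁅⁆⁻ {p = p} {y = y} x∈ = Data.Sum.map₂ (x∈⁅y⁆⇒x≡y y) (x∈p∪q⁻ p ⁅ y ⁆ x∈)

∣p∣≤1+∣p-x∣ : ∀ {n} (p : Subset n) x → ∣ p ∣ ≤ suc ∣ p - x ∣
∣p∣≤1+∣p-x∣ (inside  ∷ p) zero    = s≤s (≤-reflexive (cong ∣_∣ (sym (p─⊥≡p p))))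
∣p∣≤1+∣p-x∣ (outside ∷ p) zero    = m≤n⇒m≤1+n (≤-reflexive (cong ∣_∣ (sym (p─⊥≡p p))))
∣p∣≤1+∣p-x∣ (inside  ∷ p) (suc x) = s≤s (∣p∣≤1+∣p-x∣ p x)
∣p∣≤1+∣p-x∣ (outside ∷ p) (suc x) = ∣p∣≤1+∣p-x∣ p x

x∈p⇒∣p∣≡1+∣p-x∣ : ∀ {n} {p : Subset n} {x} → x ∈ p → ∣ p ∣ ≡ suc ∣ p - x ∣
x∈p⇒∣p∣≡1+∣p-x∣ {p = p} {x} x∈p = ≤-antisym (∣p∣≤1+∣p-x∣ p x) (x∈p⇒∣p-x∣<∣p∣ x∈p)

x∈p⇒∣p-x∣≡∣p∣∸1 : ∀ {n} {p : Subset n} {x l} → x ∈ p → ∣ p ∣ ≡ suc l → ∣ p - x ∣ ≡ l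
x∈p⇒∣p-x∣≡∣p∣∸1 x∈p ∣p∣≡1+l = suc-injective (trans (sym (x∈p⇒∣p∣≡1+∣p-x∣ x∈p)) ∣p∣≡1+l)

-- Counting by covering lists

record Cover {A : Set} (P : A → Set) (l : ℕ) : Set where
  field
    points  : List A
    length≤ : length points ≤ l
    covers  : ∀ {x} → P x → x ∈ₗ points

module _ {A : Set} where

  cover-≤ : ∀ {P : A → Set} {l l′} → l ≤ l′ → Cover P l → Cover P l′
  cover-≤ l≤l′ c = record { Cover c ; length≤ = ≤-trans (Cover.length≤ c) l≤l′ }

  cover-⊆ : ∀ {P Q : A → Set} {l} → (∀ {x} → P x → Q x) → Cover Q l → Cover P l
  cover-⊆ P⊆Q c = record { Cover c ; covers = λ Px → Cover.covers c (P⊆Q Px) }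

  cover-∪ : ∀ {P Q : A → Set} {l₁ l₂} → Cover P l₁ → Cover Q l₂ → Cover (λ x → P x ⊎ Q x) (l₁ + l₂)
  cover-∪ c d = record
    { points  = Cover.points c ++ Cover.points d
    ; length≤ = ≤-trans (≤-reflexive (length-++ (Cover.points c))) (+-mono-≤ (Cover.length≤ c) (Cover.length≤ d))
    ; covers  = λ { (inj₁ Px) → ∈-++⁺ˡ (Cover.covers c Px) ; (inj₂ Qx) → ∈-++⁺ʳ _ (Cover.covers d Qx) }
    }

  cover-∅ : ∀ {P : A → Set} {l} → (∀ {x} → ¬ P x) → Cover P l
  cover-∅ ¬P = record { points = [] ; length≤ = z≤n ; covers = λ Px → ⊥-elim (¬P Px) }

  cover-singleton : ∀ (y : A) → Cover (_≡ y) 1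
  cover-singleton y = record { points = y ∷ [] ; length≤ = ≤-refl ; covers = λ { refl → here refl } }

  cover-image : ∀ {B : Set} {P : A → Set} {l} (f : A → B) → Cover P l → Cover (λ y → ∃ λ x → P x × f x ≡ y) l
  cover-image f c = record
    { points  = map f (Cover.points c)
    ; length≤ = ≤-trans (≤-reflexive (length-map f (Cover.points c))) (Cover.length≤ c)
    ; covers  = λ { (x , Px , refl) → ∈-map⁺ f (Cover.covers c Px) }
    }

cover-subset : ∀ {n} (p : Subset n) → Cover (_∈ p) ∣ p ∣
cover-subset [] = cover-∅ λ ()
cover-subset (inside ∷ p) =
  cover-⊆ split (cover-∪ (cover-singleton zero) (cover-image suc (cover-subset p)))
  where
  split : ∀ {x} → x ∈ inside ∷ p → x ≡ zero ⊎ ∃ λ y → y ∈ p × suc y ≡ x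
  split here       = inj₁ refl
  split (there y∈) = inj₂ (_ , y∈ , refl)
cover-subset (outside ∷ p) = cover-⊆ (λ { (there y∈) → _ , y∈ , refl }) (cover-image suc (cover-subset p))

∣p∣≤length : ∀ {n} (p : Subset n) (xs : List (Fin n)) → (∀ {x} → x ∈ p → x ∈ₗ xs) → ∣ p ∣ ≤ length xs
∣p∣≤length {n} p []       p⊆[] =
  ≤-reflexive (trans (cong ∣_∣ (Empty-unique λ { (_ , x∈) → case p⊆[] x∈ of λ () })) (∣⊥∣≡0 n))
∣p∣≤length p (y ∷ xs) p⊆y∷xs = ≤-trans (∣p∣≤1+∣p-x∣ p y) (s≤s (∣p∣≤length (p - y) xs p-y⊆xs))
  where
  p-y⊆xs : ∀ {x} → x ∈ p - y → x ∈ₗ xs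
  p-y⊆xs x∈ with p⊆y∷xs (p─q⊆p p ⁅ y ⁆ x∈)
  ... | here x≡y   = ⊥-elim (x∈p-y⇒x≢y p x∈ x≡y)
  ... | there x∈xs = x∈xs

∣p∣≤cover : ∀ {n} {p : Subset n} {l} → Cover (_∈ p) l → ∣ p ∣ ≤ l
∣p∣≤cover {p = p} c = ≤-trans (∣p∣≤length p (Cover.points c) (Cover.covers c)) (Cover.length≤ c)

∣p∪⁅x⁆∣≤1+∣p∣ : ∀ {n} (p : Subset n) x → ∣ p ∪ ⁅ x ⁆ ∣ ≤ suc ∣ p ∣
∣p∪⁅x⁆∣≤1+∣p∣ p x =
  ∣p∣≤cover (cover-⊆ (Data.Sum.swap ∘ ∈-∪⁅⁆⁻) (cover-∪ (cover-singleton x) (cover-subset p)))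

cover-interval : ∀ {n} lo l → Cover {Fin n} (λ x → lo ≤ toℕ x × toℕ x < lo + l) l
cover-interval lo zero = cover-∅ λ (lo≤x , x<lo+0) → <⇒≱ x<lo+0 (≤-trans (≤-reflexive (+-identityʳ lo)) lo≤x)
cover-interval {n} lo (suc l) with lo <? n
... | no  lo≮n = cover-∅ λ (lo≤x , _) → lo≮n (≤-<-trans lo≤x (toℕ<n _))
... | yes lo<n = cover-⊆ split (cover-∪ (cover-singleton (fromℕ< lo<n)) (cover-interval (suc lo) l))
  where
  split : ∀ {x} → lo ≤ toℕ x × toℕ x < lo + suc l → x ≡ fromℕ< lo<n ⊎ (suc lo ≤ toℕ x × toℕ x < suc lo + l)
  split {x} (lo≤x , x<) with m≤n⇒m<n∨m≡n lo≤x
  ... | inj₁ lo<x = inj₂ (lo<x , subst (toℕ x <_) (+-suc lo l) x<)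
  ... | inj₂ lo≡x = inj₁ (toℕ-injective (trans (sym lo≡x) (sym (toℕ-fromℕ< lo<n))))

cover-window-above : ∀ {n} t l → Cover {Fin n} (λ x → t < toℕ x × toℕ x ≤ t + l) l
cover-window-above t l = cover-⊆ (λ (t<x , x≤t+l) → t<x , s≤s x≤t+l) (cover-interval (suc t) l)

cover-window-below : ∀ {n} t l → Cover {Fin n} (λ x → toℕ x ≤ t × t ≤ toℕ x + l) (suc l)
cover-window-below t l = cover-⊆ inside-interval (cover-interval (t ∸ l) (suc l))
  where
  inside-interval : ∀ {x} → toℕ x ≤ t × t ≤ toℕ x + l → t ∸ l ≤ toℕ x × toℕ x < t ∸ l + suc l
  inside-interval {x} (x≤t , t≤x+l) =
    m≤n+o⇒m∸n≤o t l (subst (t ≤_) (+-comm (toℕ x) l) t≤x+l) ,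
    subst (toℕ x <_) (trans (cong suc (+-comm l (t ∸ l))) (sym (+-suc (t ∸ l) l))) (s≤s (≤-trans x≤t (m≤n+m∸n t l)))

interval⊆p⇒l≤∣p∣ : ∀ {n} (p : Subset n) lo l → lo + l ≤ n →
                   (∀ {x} → lo ≤ toℕ x → toℕ x < lo + l → x ∈ p) → l ≤ ∣ p ∣
interval⊆p⇒l≤∣p∣ p lo zero    _ _ = z≤n
interval⊆p⇒l≤∣p∣ {n} p lo (suc l) lo+1+l≤n interval⊆p = begin
  suc l           ≤⟨ s≤s (interval⊆p⇒l≤∣p∣ (p - top) lo l (<⇒≤ lo+l<n) interval⊆p-top) ⟩
  suc ∣ p - top ∣ ≡⟨ sym (x∈p⇒∣p∣≡1+∣p-x∣ top∈p) ⟩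
  ∣ p ∣           ∎
  where
  open ≤-Reasoning
  lo+l<n : lo + l < n
  lo+l<n = subst (_≤ n) (+-suc lo l) lo+1+l≤n
  top = fromℕ< lo+l<n
  lo+l<lo+1+l : lo + l < lo + suc l
  lo+l<lo+1+l = +-monoʳ-< lo ≤-refl
  top∈p : top ∈ p
  top∈p = interval⊆p (subst (lo ≤_) (sym (toℕ-fromℕ< lo+l<n)) (m≤m+n lo l))
                      (subst (_< lo + suc l) (sym (toℕ-fromℕ< lo+l<n)) lo+l<lo+1+l)
  interval⊆p-top : ∀ {x} → lo ≤ toℕ x → toℕ x < lo + l → x ∈ p - top
  interval⊆p-top lo≤x x<lo+l = x∈p∧x≢y⇒x∈p-y (interval⊆p lo≤x (<-trans x<lo+l lo+l<lo+1+l))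
    λ { refl → <-irrefl (toℕ-fromℕ< lo+l<n) x<lo+l }

record Last (Q : ℕ → Set) (m : ℕ) : Set where
  field
    index   : ℕ
    index<m : index < m
    holds   : Q index
    maximal : ∀ {i} → i < m → Q i → i ≤ index

last? : ∀ {Q : ℕ → Set} → (∀ i → Dec (Q i)) → ∀ m → Last Q m ⊎ (∀ {i} → i < m → ¬ Q i)
last? Q? zero = inj₂ λ ()
last? Q? (suc m) with Q? m | last? Q? m
... | yes Qm | _ = inj₁ record { index = m ; index<m = ≤-refl ; holds = Qm ; maximal = λ i<1+m _ → s≤s⁻¹ i<1+m }
... | no ¬Qm | inj₁ L = inj₁ record
  { Last L
  ; index<m = m<n⇒m<1+n (Last.index<m L)
  ; maximal = λ i<1+m Qi →
      [ (λ i<m → Last.maximal L i<m Qi) , (λ { refl → ⊥-elim (¬Qm Qi) }) ]′ (m≤n⇒m<n∨m≡n (s≤s⁻¹ i<1+m))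
  }
... | no ¬Qm | inj₂ none = inj₂ λ i<1+m Qi →
  [ (λ i<m → none i<m Qi) , (λ { refl → ¬Qm Qi }) ]′ (m≤n⇒m<n∨m≡n (s≤s⁻¹ i<1+m))

count≤10[k+H] : ∀ {k H} → 1 ≤ k → suc k + (suc k + ((suc k + suc H) + (suc k + (H + suc H)))) ≤ 10 * (k + H)
count≤10[k+H] {suc k} {H} _ = ≤-trans (m≤m+n _ (6 * k + 7 * H)) (≤-reflexive (sym (split k H)))
  where
  split : ∀ k H → 10 * (suc k + H) ≡
    suc (suc k) + (suc (suc k) + ((suc (suc k) + suc H) + (suc (suc k) + (H + suc H)))) + (6 * k + 7 * H)
  split = solve-∀

module _ (I : Instance) where
  open Instance I

  ∈-unexpired⁻ : ∀ {τ} (p : Subset n) {x} → x ∈ p ∩ tabulate (λ y → τ <ᵇ del y) → x ∈ p × τ < del x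
  ∈-unexpired⁻ {τ} p x∈ with x∈p∩q⁻ p _ x∈
  ... | x∈p , alive = x∈p , <ᵇ⇒< τ _ (∈-tabulate⁻ alive)

  ∈-active⁺ : ∀ {t x} → arr x ≤ t → t < del x → x ∈ active I t
  ∈-active⁺ {t} arrived alive = ∈-tabulate⁺ (from T-∧ (≤⇒≤ᵇ arrived , <⇒<ᵇ alive))

  module _ (ao : ArrivalOrdered I) where

    arr-mono : ∀ {x y} → toℕ x ≤ toℕ y → arr x ≤ arr y
    arr-mono {x} {y} x≤y with m≤n⇒m<n∨m≡n x≤y
    ... | inj₁ x<y = <⇒≤ (ao x y x<y)
    ... | inj₂ x≡y = ≤-reflexive (cong arr (toℕ-injective x≡y))

    H≤∣between∣ : ∀ {H} p q → toℕ p + H < toℕ q → H ≤ ∣ between I p q ∣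
    H≤∣between∣ {H} p q p+H<q = interval⊆p⇒l≤∣p∣ (between I p q) (suc (toℕ p)) H
      (≤-trans p+H<q (<⇒≤ (toℕ<n q)))
      (λ p<x x<1+p+H → ∈-tabulate⁺ (from T-∧ (<⇒<ᵇ (ao p _ p<x) , <⇒<ᵇ (ao _ q (<-≤-trans x<1+p+H p+H<q)))))

    HOrdered⇒inversion≤H : ∀ {H} → HOrdered I H → ∀ {p q} → toℕ p ≤ toℕ q → del q ≤ del p → toℕ q ≤ toℕ p + H
    HOrdered⇒inversion≤H {H} ho {p} {q} p≤q dq≤dp with m≤n⇒m<n∨m≡n p≤q
    ... | inj₂ p≡q = subst (_≤ toℕ p + H) p≡q (m≤m+n (toℕ p) H)
    ... | inj₁ p<q = ≮⇒≥ λ p+H<q → <⇒≱ (ho p q (ao p q p<q) (H≤∣between∣ p q p+H<q)) dq≤dp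

  -- Single updates

  setRep-≡ : ∀ r (a p : Fin n) → setRep I r a p a ≡ p
  setRep-≡ r a p rewrite dec-true (a ≟ a) refl = refl

  setRep-≢ : ∀ r {a} p {x} → x ≢ a → setRep I r a p x ≡ r x
  setRep-≢ r {a} p {x} x≢a rewrite dec-false (x ≟ a) x≢a = refl

  Pruned : State I → Set
  Pruned s = ∃ λ b → b ∈ A s × (∀ q → q ∈ R s → del b ≤ del q)

  record Evicted (a p : Fin n) (s′ : State I) : Set where
    field
      del-minimal : ∀ {b} → b ∈ A s′ → del a ≤ del b
      cause       : del a ≤ arr p ⊎ Pruned s′

  Cleanup₂-A : ∀ {s s′} → Cleanup₂ I s s′ → A s′ ≡ A s
  Cleanup₂-A (prune _ _ _ _ _) = refl
  Cleanup₂-A (skip _ _)        = refl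

  Cleanup₂-pruned : ∀ {s s′} → Cleanup₂ I s s′ → ∣ A s ∣ ≡ suc k → Pruned s′
  Cleanup₂-pruned (prune s a₀ _ a₀∈ _) _ =
    a₀ , a₀∈ , λ q q∈ → ≤ᵇ⇒≤ (del a₀) (del q) (∈-tabulate⁻ (proj₂ (x∈p∩q⁻ (R s) _ q∈)))
  Cleanup₂-pruned (skip _ ∣A∣≢1+k) ∣A∣≡1+k = ⊥-elim (∣A∣≢1+k ∣A∣≡1+k)

  Cleanup-A⊆ : ∀ {s s′} → Cleanup I s s′ → ∀ {x} → x ∈ A s′ → x ∈ A s
  Cleanup-A⊆ (cleanup (rem s a _ _ _) c₂) x∈ = p─q⊆p (A s) ⁅ a ⁆ (subst (_ ∈_) (Cleanup₂-A c₂) x∈)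
  Cleanup-A⊆ (cleanup (skip _ _)      c₂) x∈ = subst (_ ∈_) (Cleanup₂-A c₂) x∈

  Cleanup₁-R : ∀ {s s′} → Cleanup₁ I s s′ → R s′ ≡ R s
  Cleanup₁-R (rem _ _ _ _ _) = refl
  Cleanup₁-R (skip _ _)      = refl

  Cleanup₁-rep : ∀ {s s′} → Cleanup₁ I s s′ → rep s′ ≡ rep s
  Cleanup₁-rep (rem _ _ _ _ _) = refl
  Cleanup₁-rep (skip _ _)      = refl

  Cleanup₂-R⊆ : ∀ {s s′} → Cleanup₂ I s s′ → ∀ {x} → x ∈ R s′ → x ∈ R s
  Cleanup₂-R⊆ (prune s _ _ _ _) x∈ = proj₁ (x∈p∩q⁻ (R s) _ x∈)
  Cleanup₂-R⊆ (skip _ _)        x∈ = x∈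

  Cleanup₂-rep : ∀ {s s′} → Cleanup₂ I s s′ → rep s′ ≡ rep s
  Cleanup₂-rep (prune _ _ _ _ _) = refl
  Cleanup₂-rep (skip _ _)        = refl

  Cleanup-R⊆ : ∀ {s s′} → Cleanup I s s′ → ∀ {x} → x ∈ R s′ → x ∈ R s
  Cleanup-R⊆ (cleanup c₁ c₂) x∈ = subst (_ ∈_) (Cleanup₁-R c₁) (Cleanup₂-R⊆ c₂ x∈)

  Cleanup-rep : ∀ {s s′} → Cleanup I s s′ → rep s′ ≡ rep s
  Cleanup-rep (cleanup c₁ c₂) = trans (Cleanup₂-rep c₂) (Cleanup₁-rep c₁)

  Cleanup-∣A∣ : ∀ {s s′} → Cleanup I s s′ → ∣ A s ∣ ≤ 2 + k → ∣ A s′ ∣ ≤ 1 + k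
  Cleanup-∣A∣ (cleanup (rem s a ∣A∣≡2+k a∈ _) c₂) _ rewrite Cleanup₂-A c₂ = ≤-reflexive (x∈p⇒∣p-x∣≡∣p∣∸1 a∈ ∣A∣≡2+k)
  Cleanup-∣A∣ (cleanup (skip _ ∣A∣≢2+k) c₂) ∣A∣≤2+k rewrite Cleanup₂-A c₂ = s≤s⁻¹ (≤∧≢⇒< ∣A∣≤2+k ∣A∣≢2+k)

  Cleanup-evicts : ∀ {s p s′ x} → Cleanup I s s′ → x ∈ A s → x ∉ A s′ → Evicted x p s′
  Cleanup-evicts {x = x} (cleanup (rem s a ∣A∣≡2+k a∈ a-minimal) c₂) x∈ x∉ with x ≟ a
  ... | no x≢a = ⊥-elim (x∉ (subst (x ∈_) (sym (Cleanup₂-A c₂)) (x∈p∧x≢y⇒x∈p-y x∈ x≢a)))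
  ... | yes refl = record
    { del-minimal = λ b∈ → a-minimal _ (p─q⊆p (A s) ⁅ a ⁆ (subst (_ ∈_) (Cleanup₂-A c₂) b∈))
    ; cause       = inj₂ (Cleanup₂-pruned c₂ (x∈p⇒∣p-x∣≡∣p∣∸1 a∈ ∣A∣≡2+k))
    }
  Cleanup-evicts (cleanup (skip _ _) c₂) x∈ x∉ = ⊥-elim (x∉ (subst (_ ∈_) (sym (Cleanup₂-A c₂)) x∈))

  Update-A⁻ : ∀ {s p s′ x} → Update I s p s′ → x ∈ A s′ → (x ∈ A s × arr p < del x) ⊎ x ≡ p
  Update-A⁻ {s} (new _ _ c)         x∈ = Data.Sum.map₁ (∈-unexpired⁻ (A s)) (∈-∪⁅⁆⁻ (Cleanup-A⊆ c x∈))
  Update-A⁻ {s} (swap _ _ _ _ _)    x∈ = inj₁ (∈-unexpired⁻ (A s) x∈)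
  Update-A⁻ {s} (discard _ _ _ _)   x∈ = inj₁ (∈-unexpired⁻ (A s) x∈)

  Update-R⁻ : ∀ {s p s′ x} → Update I s p s′ → x ∈ R s′ → (x ∈ R s × arr p < del x) ⊎ x ≡ p
  Update-R⁻ {s} (new _ _ c)         x∈ = Data.Sum.map₁ (∈-unexpired⁻ (R s)) (∈-∪⁅⁆⁻ (Cleanup-R⊆ c x∈))
  Update-R⁻ {s} (swap _ _ _ _ _)    x∈ = Data.Sum.map₁ (∈-unexpired⁻ (R s) ∘ p─q⊆p _ _) (∈-∪⁅⁆⁻ x∈)
  Update-R⁻ {s} (discard _ _ _ _)   x∈ = inj₁ (∈-unexpired⁻ (R s) x∈)

  Update-∣A∣ : ∀ {s p s′} → Update I s p s′ → ∣ A s ∣ ≤ suc k → ∣ A s′ ∣ ≤ suc k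
  Update-∣A∣ {s} {p} (new _ _ c) ∣A∣≤1+k =
    Cleanup-∣A∣ c (≤-trans (∣p∪⁅x⁆∣≤1+∣p∣ (A (expire I (arr p) s)) p) (s≤s (≤-trans (∣p∩q∣≤∣p∣ (A s) _) ∣A∣≤1+k)))
  Update-∣A∣ {s} (swap _ _ _ _ _)  ∣A∣≤1+k = ≤-trans (∣p∩q∣≤∣p∣ (A s) _) ∣A∣≤1+k
  Update-∣A∣ {s} (discard _ _ _ _) ∣A∣≤1+k = ≤-trans (∣p∩q∣≤∣p∣ (A s) _) ∣A∣≤1+k

  Update-keepsRep : ∀ {s p s′ q a} → Update I s p s′ → q ∈ R s′ → q ≢ p → a ≢ p → rep s a ≡ q → rep s′ a ≡ q
  Update-keepsRep {s} (new p _ c) _ _ a≢p refl = trans (cong (λ r → r _) (Cleanup-rep c)) (setRep-≢ (rep s) p a≢p)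
  Update-keepsRep {s} {a = a} (swap _ p a′ _ _) q∈ q≢p _ refl = setRep-≢ (rep s) p a≢a′
    where
    a≢a′ : a ≢ a′
    a≢a′ refl with ∈-∪⁅⁆⁻ q∈
    ... | inj₁ q∈R-q = x∈p-y⇒x≢y _ q∈R-q refl
    ... | inj₂ q≡p   = q≢p q≡p
  Update-keepsRep (discard _ _ _ _) _ _ _ rep≡q = rep≡q

  Update-newRep : ∀ {s p s′} → Update I s p s′ → p ∉ R s → p ∈ R s′ →
                  (∃ λ a → a ∈ A s′ × rep s′ a ≡ p) ⊎ (rep s′ p ≡ p × Evicted p p s′)
  Update-newRep {s} {s′ = s′} (new p _ c) _ _ = case p ∈? A s′ of λ where
      (yes p∈) → inj₁ (p , p∈ , p↦p)
      (no  p∉) → inj₂ (p↦p , Cleanup-evicts c (x∈p∪q⁺ (inj₂ (x∈⁅x⁆ p))) p∉)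
    where
    p↦p : rep s′ p ≡ p
    p↦p = trans (cong (λ r → r p) (Cleanup-rep c)) (setRep-≡ (rep s) p p)
  Update-newRep {s} (swap _ p a _ a∈E′) _ _ =
    inj₁ (a , proj₁ (x∈p∩q⁻ _ _ (proj₁ (x∈p∩q⁻ _ _ a∈E′))) , setRep-≡ (rep s) a p)
  Update-newRep {s} (discard _ _ _ _) p∉R p∈R′ = ⊥-elim (p∉R (proj₁ (∈-unexpired⁻ (R s) p∈R′)))

  module _ (abd : ArrBeforeDel I) where

    Update-A-alive : ∀ {s p s′ x} → Update I s p s′ → x ∈ A s′ → arr p < del x
    Update-A-alive u x∈ = [ proj₂ , (λ { refl → abd _ }) ]′ (Update-A⁻ u x∈)

    Update-R-alive : ∀ {s p s′ x} → Update I s p s′ → x ∈ R s′ → arr p < del x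
    Update-R-alive u x∈ = [ proj₂ , (λ { refl → abd _ }) ]′ (Update-R⁻ u x∈)

    Update-evicts : ∀ {s p s′ a} → Update I s p s′ → a ∈ A s → a ∉ A s′ → Evicted a p s′
    Update-evicts {s} {p} {a = a} u a∈ a∉ with arr p <? del a
    ... | no expired = record
      { del-minimal = λ b∈ → ≤-trans (≮⇒≥ expired) (<⇒≤ (Update-A-alive u b∈))
      ; cause       = inj₁ (≮⇒≥ expired) }
    ... | yes alive = evicted u (x∈p∩q⁺ (a∈ , ∈-tabulate⁺ (<⇒<ᵇ alive))) a∉
      where
      evicted : ∀ {s′} → Update I s p s′ → a ∈ A (expire I (arr p) s) → a ∉ A s′ → Evicted a p s′
      evicted (new _ _ c) a∈′ a∉′ = Cleanup-evicts c (x∈p∪q⁺ (inj₁ a∈′)) a∉′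
      evicted (swap _ _ _ _ _)  a∈′ a∉′ = ⊥-elim (a∉′ a∈′)
      evicted (discard _ _ _ _) a∈′ a∉′ = ⊥-elim (a∉′ a∈′)

  -- Executions

  record Execution (m : ℕ) (s : State I) : Set where
    field
      state       : ℕ → State I
      state-0     : state 0 ≡ initial I
      state-step  : ∀ p → toℕ p < m → Update I (state (toℕ p)) p (state (suc (toℕ p)))
      state-final : state m ≡ s
      m≤n         : m ≤ n

  run⇒execution : ∀ {m s} → Run I m s → Execution m s
  run⇒execution start = record
    { state = λ _ → initial I ; state-0 = refl ; state-step = λ _ () ; state-final = refl ; m≤n = z≤n }
  run⇒execution (step {s' = s′} p run u) = record
    { state       = state′
    ; state-0     = trans (before z≤n) state-0
    ; state-step  = step′
    ; state-final = after
    ; m≤n         = toℕ<n p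
    }
    where
    open Execution (run⇒execution run)
    state′ : ℕ → State I
    state′ i = if does (i ≤? toℕ p) then state i else s′
    before : ∀ {i} → i ≤ toℕ p → state′ i ≡ state i
    before {i} i≤p rewrite dec-true (i ≤? toℕ p) i≤p = refl
    after : state′ (suc (toℕ p)) ≡ s′
    after rewrite dec-false (suc (toℕ p) ≤? toℕ p) (<-irrefl refl) = refl
    step′ : ∀ q → toℕ q < suc (toℕ p) → Update I (state′ (toℕ q)) q (state′ (suc (toℕ q)))
    step′ q q<1+p with m≤n⇒m<n∨m≡n (s≤s⁻¹ q<1+p)
    ... | inj₁ q<p = subst₂ (λ t t′ → Update I t q t′) (sym (before (<⇒≤ q<p))) (sym (before q<p)) (state-step q q<p)
    ... | inj₂ q≡p with toℕ-injective q≡p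
    ... | refl = subst₂ (λ t t′ → Update I t q t′) (sym (trans (before ≤-refl) state-final)) (sym after) u

  module _ (abd : ArrBeforeDel I) {m s} (E : Execution m s) where
    open Execution E

    execution-ind : (P : ℕ → Set) → P 0 → (∀ p → toℕ p < m → P (toℕ p) → P (suc (toℕ p))) → ∀ {j} → j ≤ m → P j
    execution-ind P P0 Pstep {zero}  _   = P0
    execution-ind P P0 Pstep {suc j} j<m with fromℕ< (<-≤-trans j<m m≤n) | toℕ-fromℕ< (<-≤-trans j<m m≤n)
    ... | p | refl = Pstep p j<m (execution-ind P P0 Pstep (<⇒≤ j<m))

    module History (F : State I → Subset n) (F-0 : ∀ {x} → x ∉ F (initial I))
                   (F-step : ∀ {s p s′ x} → Update I s p s′ → x ∈ F s′ → x ∈ F s ⊎ x ≡ p) where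

      arrived : ∀ {j} → j ≤ m → ∀ {x} → x ∈ F (state j) → toℕ x < j
      arrived = execution-ind (λ j → ∀ {x} → x ∈ F (state j) → toℕ x < j)
        (λ x∈ → ⊥-elim (F-0 (subst (λ t → _ ∈ F t) state-0 x∈)))
        (λ p p<m ih x∈ → [ m<n⇒m<1+n ∘ ih , (λ { refl → ≤-refl }) ]′ (F-step (state-step p p<m) x∈))

      persisted : ∀ {j} → j ≤ m → ∀ {x} → x ∈ F (state j) → ∀ {i} → toℕ x < i → i ≤ j → x ∈ F (state i)
      persisted = execution-ind (λ j → ∀ {x} → x ∈ F (state j) → ∀ {i} → toℕ x < i → i ≤ j → x ∈ F (state i))
        (λ _ x<i i≤0 → ⊥-elim (<⇒≱ x<i (≤-trans i≤0 z≤n)))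
        λ p p<m ih x∈ x<i i≤1+p → case m≤n⇒m<n∨m≡n i≤1+p of λ where
          (inj₂ refl)  → x∈
          (inj₁ i<1+p) → case F-step (state-step p p<m) x∈ of λ where
            (inj₁ x∈′)  → ih x∈′ x<i (s≤s⁻¹ i<1+p)
            (inj₂ refl) → ⊥-elim (<⇒≱ x<i (s≤s⁻¹ i<1+p))

    module A-history = History A ∉⊥ (λ u x∈ → Data.Sum.map₁ proj₁ (Update-A⁻ u x∈))
    module R-history = History R ∉⊥ (λ u x∈ → Data.Sum.map₁ proj₁ (Update-R⁻ u x∈))

    ∣A∣≤1+k : ∀ {j} → j ≤ m → ∣ A (state j) ∣ ≤ suc k
    ∣A∣≤1+k = execution-ind (λ j → ∣ A (state j) ∣ ≤ suc k)
      (subst (λ t → ∣ A t ∣ ≤ suc k) (sym state-0) (≤-trans (≤-reflexive (∣⊥∣≡0 n)) z≤n))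
      (λ p p<m → Update-∣A∣ (state-step p p<m))

    -- the attractor a of q left A in the update of the point at
    record Orphaned (j : ℕ) (a q : Fin n) : Set where
      field
        at         : Fin n
        at<j       : toℕ at < j
        q≤at       : toℕ q ≤ toℕ at
        attracting : ∀ {i} → toℕ a < i → i ≤ toℕ at → a ∈ A (state i)
        evicted    : Evicted a at (state (suc (toℕ at)))

    record Owner (j : ℕ) (q : Fin n) : Set where
      field
        attractor   : Fin n
        represents  : rep (state j) attractor ≡ q
        attractor≤q : toℕ attractor ≤ toℕ q
        status      : attractor ∈ A (state j) ⊎ Orphaned j attractor q

    owner-new : ∀ p → toℕ p < m → p ∈ R (state (suc (toℕ p))) → Owner (suc (toℕ p)) p
    owner-new p p<m p∈
      with Update-newRep (state-step p p<m) (λ p∈R → <-irrefl refl (R-history.arrived (<⇒≤ p<m) p∈R)) p∈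
    ... | inj₁ (a , a∈ , a↦p) = record
      { attractor = a ; represents = a↦p ; attractor≤q = s≤s⁻¹ (A-history.arrived p<m a∈) ; status = inj₁ a∈ }
    ... | inj₂ (p↦p , evicted) = record
      { attractor = p ; represents = p↦p ; attractor≤q = ≤-refl ; status = inj₂ record
        { at = p ; at<j = ≤-refl ; q≤at = ≤-refl ; attracting = λ p<i i≤p → ⊥-elim (<⇒≱ p<i i≤p)
        ; evicted = evicted } }

    owner-old : ∀ p → toℕ p < m → ∀ {q} → q ∈ R (state (suc (toℕ p))) → q ∈ R (state (toℕ p)) →
                Owner (toℕ p) q → Owner (suc (toℕ p)) q
    owner-old p p<m {q} q∈′ q∈ o = record
      { attractor   = a
      ; represents  = Update-keepsRep u q∈′ (λ { refl → <-irrefl refl q<p })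
                                            (λ { refl → <-irrefl refl (≤-<-trans attractor≤q q<p) }) represents
      ; attractor≤q = attractor≤q
      ; status      = status′ status
      }
      where
      open Owner o renaming (attractor to a)
      u = state-step p p<m
      q<p = R-history.arrived (<⇒≤ p<m) q∈
      status′ : a ∈ A (state (toℕ p)) ⊎ Orphaned (toℕ p) a q →
                a ∈ A (state (suc (toℕ p))) ⊎ Orphaned (suc (toℕ p)) a q
      status′ (inj₂ orphaned) = inj₂ record { Orphaned orphaned ; at<j = m<n⇒m<1+n (Orphaned.at<j orphaned) }
      status′ (inj₁ a∈) with a ∈? A (state (suc (toℕ p)))
      ... | yes a∈′ = inj₁ a∈′
      ... | no  a∉′ = inj₂ record
        { at = p ; at<j = ≤-refl ; q≤at = <⇒≤ q<p ; attracting = A-history.persisted (<⇒≤ p<m) a∈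
        ; evicted = Update-evicts abd u a∈ a∉′ }

    owner : ∀ {j} → j ≤ m → ∀ {q} → q ∈ R (state j) → Owner j q
    owner = execution-ind (λ j → ∀ {q} → q ∈ R (state j) → Owner j q)
      (λ q∈ → ⊥-elim (∉⊥ (subst (λ t → _ ∈ R t) state-0 q∈)))
      (λ p p<m ih q∈ → [ (λ (q∈R , _) → owner-old p p<m q∈ q∈R (ih q∈R)) , (λ { refl → owner-new p p<m q∈ }) ]′
                         (Update-R⁻ (state-step p p<m) q∈))

    -- Counting the representatives

    module Counting (ao : ArrivalOrdered I) {H} (ho : HOrdered I H) (τ : ℕ) (arr≤τ : ∀ x → toℕ x < m → arr x ≤ τ) where

      Live : Fin n → Set
      Live q = q ∈ R (state m) × τ < del q

      Reps : ℕ → Fin n → Set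
      Reps j q = ∃ λ a → a ∈ A (state j) × rep (state m) a ≡ q

      record Orphan (q : Fin n) : Set where
        field
          attractor   : Fin n
          represents  : rep (state m) attractor ≡ q
          attractor≤q : toℕ attractor ≤ toℕ q
          orphaned    : Orphaned m attractor q
        open Orphaned orphaned public

        attractor<m : toℕ attractor < m
        attractor<m = ≤-<-trans (≤-trans attractor≤q q≤at) at<j

      PrunedAt : ℕ → Set
      PrunedAt c = Pruned (state (suc c))

      ExpiredOrphan : Fin n → Set
      ExpiredOrphan q = Live q × Σ (Orphan q) λ o → del (Orphan.attractor o) ≤ τ

      PrunedOrphan : Fin n → Set
      PrunedOrphan q = Live q × Σ (Orphan q) λ o → ∃ λ c → toℕ (Orphan.at o) ≤ c × c < m × PrunedAt c

      live-cases : ∀ {q} → Live q → Reps m q ⊎ ExpiredOrphan q ⊎ PrunedOrphan q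
      live-cases {q} live with owner ≤-refl (proj₁ live)
      ... | record { attractor = a ; represents = a↦q ; status = inj₁ a∈ } = inj₁ (a , a∈ , a↦q)
      ... | record { attractor = a ; represents = a↦q ; attractor≤q = a≤q ; status = inj₂ orphaned } =
        inj₂ (Data.Sum.map (λ expired → live , o , ≤-trans expired (arr≤τ at at<j))
                           (λ pruned → live , o , toℕ at , ≤-refl , at<j , pruned)
                           cause)
        where
        o : Orphan q
        o = record { attractor = a ; represents = a↦q ; attractor≤q = a≤q ; orphaned = orphaned }
        open Orphan o using (at; at<j; evicted)
        open Evicted evicted using (cause)

      cover-reps : ∀ {j} → j ≤ m → Cover (Reps j) (suc k)
      cover-reps {j} j≤m = cover-≤ (∣A∣≤1+k j≤m) (cover-image (rep (state m)) (cover-subset (A (state j))))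

      JustBefore : ℕ → Fin n → Set
      JustBefore t q = toℕ q ≤ t × t ≤ toℕ q + H

      RepsJustAfter : ℕ → Fin n → Set
      RepsJustAfter t q = ∃ λ a → (t < toℕ a × toℕ a ≤ t + H) × rep (state m) a ≡ q

      Expired : ℕ → Set
      Expired i = ∃ λ x → toℕ x ≡ i × del x ≤ τ

      expired? : ∀ i → Dec (Expired i)
      expired? i = any? λ x → (toℕ x ≟ℕ i) ×-dec (del x ≤? τ)

      expired-orphan-cases : (L : Last Expired m) → ∀ {q} → ExpiredOrphan q →
                             Reps (suc (Last.index L)) q ⊎ JustBefore (Last.index L) q
      expired-orphan-cases L {q} ((_ , τ<del-q) , o , a-expired) = cases (toℕ q <? X)
        where
        open Orphan o
        open Last L renaming (index to X)
        x≡X = proj₁ (proj₂ holds)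
        x-expired = proj₂ (proj₂ holds)
        cases : Dec (toℕ q < X) → Reps (suc X) q ⊎ JustBefore X q
        cases (yes q<X) = inj₂ (<⇒≤ q<X , subst (_≤ toℕ q + H) x≡X
          (HOrdered⇒inversion≤H ao ho (subst (toℕ q ≤_) (sym x≡X) (<⇒≤ q<X)) (≤-trans x-expired (<⇒≤ τ<del-q))))
        cases (no  q≮X) = inj₁ (attractor , attracting (s≤s a≤X) (≤-trans X<q q≤at) , represents)
          where
          a≤X = maximal attractor<m (attractor , refl , a-expired)
          X<q = ≤∧≢⇒< (≮⇒≥ q≮X) λ X≡q → <⇒≱ τ<del-q (subst (λ y → del y ≤ τ) (toℕ-injective (trans x≡X X≡q)) x-expired)

      cover-expired : Cover ExpiredOrphan (suc k + suc H)
      cover-expired with last? expired? m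
      ... | inj₂ none = cover-∅ λ (_ , o , a-expired) → none (Orphan.attractor<m o) (_ , refl , a-expired)
      ... | inj₁ L =
        cover-⊆ (expired-orphan-cases L) (cover-∪ (cover-reps (Last.index<m L)) (cover-window-below (Last.index L) H))

      pruned-orphan-cases : (L : Last PrunedAt m) → ∀ {q} → PrunedOrphan q → let b = toℕ (proj₁ (Last.holds L)) in
                            Reps (suc b) q ⊎ RepsJustAfter b q ⊎ JustBefore b q
      pruned-orphan-cases L {q} ((q∈ , _) , o , c , at≤c , c<m , pruned-c) =
        cases (toℕ q ≤? toℕ b) (toℕ attractor ≤? toℕ b)
        where
        open Orphan o
        open Last L renaming (index to P)
        b = proj₁ holds
        b∈ = proj₁ (proj₂ holds)
        b-floor = proj₂ (proj₂ holds)
        at≤P = ≤-trans at≤c (maximal c<m pruned-c)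
        cases : Dec (toℕ q ≤ toℕ b) → Dec (toℕ attractor ≤ toℕ b) →
                Reps (suc (toℕ b)) q ⊎ RepsJustAfter (toℕ b) q ⊎ JustBefore (toℕ b) q
        cases (yes q≤b) _ = inj₂ (inj₂ (q≤b , HOrdered⇒inversion≤H ao ho q≤b
          (b-floor q (R-history.persisted ≤-refl q∈ (s≤s (≤-trans q≤at at≤P)) index<m))))
        cases (no q≰b) (yes a≤b) = inj₁ (attractor , attracting (s≤s a≤b) (≤-trans (≰⇒> q≰b) q≤at) , represents)
        cases (no q≰b) (no  a≰b) =
          inj₂ (inj₁ (attractor , (b<a , HOrdered⇒inversion≤H ao ho (<⇒≤ b<a) del-a≤del-b) , represents))
          where
          b<a = ≰⇒> a≰b
          del-a≤del-b = Evicted.del-minimal evicted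
            (A-history.persisted index<m b∈ (s≤s (≤-trans (<⇒≤ b<a) (≤-trans attractor≤q q≤at))) (s≤s at≤P))

      pruned? : ∀ c → Dec (PrunedAt c)
      pruned? c = any? λ b → (b ∈? A (state (suc c))) ×-dec all? λ q → (q ∈? R (state (suc c))) →-dec (del b ≤? del q)

      cover-pruned : Cover PrunedOrphan (suc k + (H + suc H))
      cover-pruned with last? pruned? m
      ... | inj₂ none = cover-∅ λ (_ , _ , _ , _ , c<m , pruned-c) → none c<m pruned-c
      ... | inj₁ L = cover-⊆ (pruned-orphan-cases L)
        (cover-∪ (cover-reps (≤-trans (A-history.arrived index<m b∈) index<m))
                 (cover-∪ (cover-image (rep (state m)) (cover-window-above (toℕ b) H)) (cover-window-below (toℕ b) H)))
        where
        open Last L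
        b = proj₁ holds
        b∈ = proj₁ (proj₂ holds)

      cover-live : Cover Live (suc k + ((suc k + suc H) + (suc k + (H + suc H))))
      cover-live = cover-⊆ live-cases (cover-∪ (cover-reps ≤-refl) (cover-∪ cover-expired cover-pruned))

      bound : 1 ≤ k → ∀ (A′ R′ : Subset n) →
              (∀ {x} → x ∈ A′ → x ∈ A (state m) × τ < del x) → (∀ {x} → x ∈ R′ → Live x) →
              ∣ A′ ∣ + ∣ R′ ∣ ≤ 10 * ((k + H) ⊓ ∣ active I τ ∣)
      bound 1≤k A′ R′ A′-live R′-live = begin
        ∣ A′ ∣ + ∣ R′ ∣                         ≤⟨ ⊓-glb (≤-trans (+-mono-≤ ∣A′∣≤1+k ∣R′∣≤) (count≤10[k+H] 1≤k))
                                                         (≤-trans (+-mono-≤ ∣A′∣≤∣X∣ ∣R′∣≤∣X∣) ∣X∣+∣X∣≤10∣X∣) ⟩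
        (10 * (k + H)) ⊓ (10 * ∣ active I τ ∣)  ≡⟨ *-distribˡ-⊓ 10 (k + H) _ ⟨
        10 * ((k + H) ⊓ ∣ active I τ ∣)         ∎
        where
        open ≤-Reasoning
        ∣A′∣≤1+k = ≤-trans (p⊆q⇒∣p∣≤∣q∣ (proj₁ ∘ A′-live)) (∣A∣≤1+k ≤-refl)
        ∣R′∣≤ = ∣p∣≤cover (cover-⊆ R′-live cover-live)
        ∣A′∣≤∣X∣ = p⊆q⇒∣p∣≤∣q∣ λ x∈ → let (x∈A , alive) = A′-live x∈ in
          ∈-active⁺ (arr≤τ _ (A-history.arrived ≤-refl x∈A)) alive
        ∣R′∣≤∣X∣ = p⊆q⇒∣p∣≤∣q∣ λ x∈ → let (x∈R , alive) = R′-live x∈ in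
          ∈-active⁺ (arr≤τ _ (R-history.arrived ≤-refl x∈R)) alive
        ∣X∣+∣X∣≤10∣X∣ = +-monoʳ-≤ ∣ active I τ ∣ (m≤m+n ∣ active I τ ∣ (8 * ∣ active I τ ∣))

  module _ (ao : ArrivalOrdered I) (abd : ArrBeforeDel I) {H} (ho : HOrdered I H) (1≤k : 1 ≤ k) where

    bound-after-update : ∀ p s → Run I (suc (toℕ p)) s → ∣ A s ∣ + ∣ R s ∣ ≤ 10 * ((k + H) ⊓ ∣ active I (arr p) ∣)
    bound-after-update p s run =
      bound 1≤k (A s) (R s) (λ x∈ → A-final x∈ , Update-A-alive abd last-step (A-final x∈))
                            (λ x∈ → R-final x∈ , Update-R-alive abd last-step (R-final x∈))
      where
      open Execution (run⇒execution run)
      open Counting abd (run⇒execution run) ao ho (arr p) (λ _ x<1+p → arr-mono ao (s≤s⁻¹ x<1+p))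
      last-step = state-step p ≤-refl
      A-final : ∀ {x} → x ∈ A s → x ∈ A (state (suc (toℕ p)))
      A-final = subst (λ t → _ ∈ A t) (sym state-final)
      R-final : ∀ {x} → x ∈ R s → x ∈ R (state (suc (toℕ p)))
      R-final = subst (λ t → _ ∈ R t) (sym state-final)

    bound-after-query : ∀ t m s → (∀ x → toℕ x < m → arr x ≤ t) → Run I m s →
                        ∣ A (expire I t s) ∣ + ∣ R (expire I t s) ∣ ≤ 10 * ((k + H) ⊓ ∣ active I t ∣)
    bound-after-query t m s arr≤t run =
      bound 1≤k _ _ (λ x∈ → Data.Product.map₁ A-final (∈-unexpired⁻ (A s) x∈))
                    (λ x∈ → Data.Product.map₁ R-final (∈-unexpired⁻ (R s) x∈))
      where
      open Execution (run⇒execution run)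
      open Counting abd (run⇒execution run) ao ho t arr≤t
      A-final : ∀ {x} → x ∈ A s → x ∈ A (state m)
      A-final = subst (λ t → _ ∈ A t) (sym state-final)
      R-final : ∀ {x} → x ∈ R s → x ∈ R (state m)
      R-final = subst (λ t → _ ∈ R t) (sym state-final)

open Instance

lemma4p4 : ∃ λ (C : ℕ) → ∀ (I : Instance) (H : ℕ) → 1 ≤ k I →
    ArrivalOrdered I → ArrBeforeDel I → HOrdered I H →
    ((∀ (p : Fin (n I)) (s : State I) → Run I (suc (toℕ p)) s →
        ∣ A s ∣ + ∣ R s ∣ ≤ C * ((k I + H) ⊓ ∣ active I (arr I p) ∣))
    × (∀ (t m : ℕ) (s : State I) →
        (∀ (x : Fin (n I)) → toℕ x < m → arr I x ≤ t) →
        (∀ (x : Fin (n I)) → m ≤ toℕ x → t < arr I x) →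
        Run I m s →
        ∣ A (expire I t s) ∣ + ∣ R (expire I t s) ∣ ≤ C * ((k I + H) ⊓ ∣ active I t ∣)))
lemma4p4 = 10 , λ I H 1≤k ao abd ho →
  bound-after-update I ao abd ho 1≤k ,
  λ t m s arr≤t _ → bound-after-query I ao abd ho 1≤k t m s arr≤t
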